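{- Let $\mathcal M'$ be a matroid and let $G=(V,E)$ be a directed acyclic graph whose vertices are elements of the ground set of $\mathcal M'$. Suppose every non-sink vertex $u$ of $G$ is spanned in $\mathcal M'$ by the set $\delta^+_G(u)$ of its out-neighbours. Then for every set $S\subseteq V$ which is independent in $\mathcal M'$ there exists an injective function $\psi_S:S\to V$ such that, for every $u\in S$, $\psi_S(u)$ is a sink of $G$ which is reachable from $u$ (by a directed path, possibly of length zero).
   Context: An element $u$ is spanned by a set $S$ in a matroid if the maximum size of an independent subset of $S$ equals the maximum size of an independent subset of $S\cup\{u\}$. A sink is a vertex with no outgoing arcs. -}

module Defs where

open import Data.Nat using (ℕ; _<_; _≤_)
open import Data.Fin using (Fin)
open import Data.Fin.Subset using (Subset; _∈_; _∉_; _⊆_; _∪_; ⁅_⁆; ⊥; ∣_∣; Empty)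
open import Data.Product using (Σ; ∃; _×_)
open import Relation.Nullary using (¬_)
open import Relation.Binary.Construct.Closure.Transitive using (TransClosure)
open import Relation.Binary.Construct.Closure.ReflexiveTransitive using (Star)

record Matroid (n : ℕ) : Set₁ where
  field
    Indep      : Subset n → Set
    indep-∅    : Indep ⊥
    indep-⊆    : ∀ {I J} → I ⊆ J → Indep J → Indep I
    augment    : ∀ {I J} → Indep I → Indep J → ∣ I ∣ < ∣ J ∣ →
                 ∃ λ x → x ∈ J × x ∉ I × Indep (I ∪ ⁅ x ⁆)
open Matroid public

-- u is spanned by S: the maximum size of an independent subset of S equals
-- the maximum size of an independent subset of S ∪ {u}.  Since every subset
-- of S is a subset of S ∪ {u}, this says: every independent subset of
-- S ∪ {u} has size at most that of some independent subset of S.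
Spans : ∀ {n} → Matroid n → Subset n → Fin n → Set
Spans M S u = ∀ I → I ⊆ S ∪ ⁅ u ⁆ → Indep M I →
              Σ (Subset _) λ J → J ⊆ S × Indep M J × ∣ I ∣ ≤ ∣ J ∣

record Digraph (n : ℕ) : Set where
  field
    V      : Subset n
    out    : Fin n → Subset n
    arc-V  : ∀ u w → w ∈ out u → u ∈ V × w ∈ V
open Digraph public

Arc : ∀ {n} → Digraph n → Fin n → Fin n → Set
Arc G u w = w ∈ out G u

Acyclic : ∀ {n} → Digraph n → Set
Acyclic G = ∀ v → ¬ TransClosure (Arc G) v v

Reachable : ∀ {n} → Digraph n → Fin n → Fin n → Set
Reachable G = Star (Arc G)

Sink : ∀ {n} → Digraph n → Fin n → Set
Sink G u = u ∈ V G × Empty (out G u)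

-- Keep an independent set T ⊆ V together with an injection ψ : S → T such
-- that ψ u is reachable from u; initially T = S and ψ = id.  While some
-- v ∈ T is not a sink, v is spanned by its out-neighbours, so a matroid
-- exchange replaces v in T by an out-neighbour w ∉ T - v, keeping T
-- independent; the element of S routed to v is rerouted to w.  Pushing
-- each vertex down in this way terminates because G is acyclic, hence
-- well-founded along arcs, and once every vertex has been pushed, T
-- consists of sinks.
module Submission where

open import Defs
open import Data.Nat using (ℕ; _∸_; _<_; _≤_; s≤s)
open import Data.Nat.Properties using (≤-trans; <-≤-trans; ≰⇒>; _≤?_; ∸-monoʳ-<)
open import Data.Nat.Induction using (<-wellFounded)
open import Data.Fin using (Fin; _≟_)
open import Data.Fin.Subset using (Subset; _∈_; _∉_; _⊆_; _∪_; _─_; _-_; ⁅_⁆; ∣_∣; outside; inside)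
open import Data.Fin.Subset.Properties
  using (x∈⁅x⁆; x∈⁅y⁆⇒x≡y; x∉⁅y⁆⇒x≢y; x∈p∧x≢y⇒x∈p-y; p─q⊆p; x∈p⇒∣p-x∣<∣p∣; p⊆q⇒∣p∣≤∣q∣;
         p⊆p∪q; q⊆p∪q; x∈p∪q⁻; ∣p∣≤n; ∉⊥; nonempty?; _∈?_)
open import Data.Fin.Induction using (spo-noetherian)
open import Data.Vec using (_∷_; here; there)
open import Data.List using (List; []; _∷_; allFin)
open import Data.List.Relation.Unary.Any using () renaming (here to hereₗ; there to thereₗ)
import Data.List.Membership.Propositional as List
open import Data.List.Membership.Propositional.Properties using (∈-allFin)
open import Data.Product using (Σ; ∃; _×_; _,_; proj₂)
open import Data.Sum using (_⊎_; inj₁; inj₂; [_,_]′)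
open import Data.Empty using (⊥-elim)
open import Function using (id; flip; _on_; _∘_)
open import Induction.WellFounded using (WellFounded; Acc; acc; module Subrelation)
open import Relation.Nullary using (¬_; yes; no; contradiction)
open import Relation.Binary.Structures using (IsStrictPartialOrder)
open import Relation.Binary.PropositionalEquality
  using (_≡_; refl; sym; trans; subst; resp₂; isEquivalence)
import Relation.Binary.Construct.On as On
open import Relation.Binary.Construct.Closure.Transitive using (TransClosure; [_]; _++_)
open import Relation.Binary.Construct.Closure.ReflexiveTransitive using (Star; ε; _◅_; _◅◅_)

private
  variable
    n : ℕ

x∈p─q⇒x∉q : ∀ {x : Fin n} {p q : Subset n} → x ∈ p ─ q → x ∉ q
x∈p─q⇒x∉q {p = _ ∷ _} {outside ∷ _} here      ()
x∈p─q⇒x∉q {p = _ ∷ _} {inside  ∷ _} ()        here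
x∈p─q⇒x∉q {p = _ ∷ _} {_       ∷ _} (there h) (there k) = x∈p─q⇒x∉q h k

x∈p∪⁅y⁆⁻ : ∀ {x y : Fin n} (p : Subset n) → x ∈ p ∪ ⁅ y ⁆ → x ∈ p ⊎ x ≡ y
x∈p∪⁅y⁆⁻ {y = y} p x∈ with x∈p∪q⁻ p ⁅ y ⁆ x∈
... | inj₁ x∈p  = inj₁ x∈p
... | inj₂ x∈⁅y⁆ = inj₂ (x∈⁅y⁆⇒x≡y y x∈⁅y⁆)

x∈p∪⁅y⁆-y⇒x∈p : ∀ {x y : Fin n} (p : Subset n) → x ∈ (p ∪ ⁅ y ⁆) - y → x ∈ p
x∈p∪⁅y⁆-y⇒x∈p {y = y} p x∈ with x∈p∪⁅y⁆⁻ p (p─q⊆p _ ⁅ y ⁆ x∈)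
... | inj₁ x∈p = x∈p
... | inj₂ x≡y = contradiction x≡y (x∉⁅y⁆⇒x≢y (x∈p─q⇒x∉q x∈))

y∈p∪⁅y⁆ : ∀ (p : Subset n) y → y ∈ p ∪ ⁅ y ⁆
y∈p∪⁅y⁆ p y = q⊆p∪q p ⁅ y ⁆ (x∈⁅x⁆ y)

p∪⁅y⁆⊆q : ∀ {p q : Subset n} {y} → p ⊆ q → y ∈ q → p ∪ ⁅ y ⁆ ⊆ q
p∪⁅y⁆⊆q {p = p} p⊆q y∈q x∈ with x∈p∪⁅y⁆⁻ p x∈
... | inj₁ x∈p = p⊆q x∈p
... | inj₂ refl = y∈q

x∉p⇒∣p∣<∣p∪⁅x⁆∣ : ∀ {x} {p : Subset n} → x ∉ p → ∣ p ∣ < ∣ p ∪ ⁅ x ⁆ ∣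
x∉p⇒∣p∣<∣p∪⁅x⁆∣ {x = x} {p} x∉p =
  ≤-trans (s≤s (p⊆q⇒∣p∣≤∣q∣ p⊆p∪⁅x⁆-x)) (x∈p⇒∣p-x∣<∣p∣ (y∈p∪⁅y⁆ p x))
  where
  p⊆p∪⁅x⁆-x : p ⊆ (p ∪ ⁅ x ⁆) - x
  p⊆p∪⁅x⁆-x y∈p = x∈p∧x≢y⇒x∈p-y (p⊆p∪q ⁅ x ⁆ y∈p) λ { refl → x∉p y∈p }

growth-induction : ∀ (P : Subset n → Set) {R : Set} →
                   (∀ {E} → P E → R ⊎ ∃ λ E′ → P E′ × ∣ E ∣ < ∣ E′ ∣) →
                   ∀ {E} → P E → R
growth-induction {n} P {R} step {E} = go (deficit-wellFounded E)
  where
  deficit-wellFounded : WellFounded (_<_ on λ E → n ∸ ∣ E ∣)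
  deficit-wellFounded = On.wellFounded (λ E → n ∸ ∣ E ∣) <-wellFounded

  go : ∀ {E} → Acc (_<_ on λ E → n ∸ ∣ E ∣) E → P E → R
  go (acc rs) pE with step pE
  ... | inj₁ r = r
  ... | inj₂ (E′ , pE′ , ∣E∣<∣E′∣) = go (rs (∸-monoʳ-< ∣E∣<∣E′∣ (∣p∣≤n E′))) pE′

module _ (M : Matroid n) where

  augment-to-size : ∀ {I J} → Indep M I → Indep M J →
                    ∃ λ D → I ⊆ D × D ⊆ I ∪ J × Indep M D × ∣ J ∣ ≤ ∣ D ∣
  augment-to-size {I} {J} iI iJ =
    growth-induction Between step (id , p⊆p∪q J , iI)
    where
    Between : Subset n → Set
    Between D = I ⊆ D × D ⊆ I ∪ J × Indep M D

    step : ∀ {D} → Between D →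
           (∃ λ D → I ⊆ D × D ⊆ I ∪ J × Indep M D × ∣ J ∣ ≤ ∣ D ∣) ⊎
           (∃ λ D′ → Between D′ × ∣ D ∣ < ∣ D′ ∣)
    step {D} (I⊆D , D⊆I∪J , iD) with ∣ J ∣ ≤? ∣ D ∣
    ... | yes ∣J∣≤∣D∣ = inj₁ (D , I⊆D , D⊆I∪J , iD , ∣J∣≤∣D∣)
    ... | no ∣J∣≰∣D∣ with augment M iD iJ (≰⇒> ∣J∣≰∣D∣)
    ...   | x , x∈J , x∉D , iDx =
      inj₂ (D ∪ ⁅ x ⁆ , (p⊆p∪q ⁅ x ⁆ ∘ I⊆D , p∪⁅y⁆⊆q D⊆I∪J (q⊆p∪q I J x∈J) , iDx)
                      , x∉p⇒∣p∣<∣p∪⁅x⁆∣ x∉D)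

  spanned-augment : ∀ {O E u} → Spans M O u → E ⊆ O → u ∉ E → Indep M (E ∪ ⁅ u ⁆) →
                    ∃ λ y → y ∈ O × y ∉ E × Indep M (E ∪ ⁅ y ⁆)
  spanned-augment {O} {E} {u} spans E⊆O u∉E iEu
    with spans (E ∪ ⁅ u ⁆) (p∪⁅y⁆⊆q (p⊆p∪q ⁅ u ⁆ ∘ E⊆O) (y∈p∪⁅y⁆ O u)) iEu
  ... | J , J⊆O , iJ , ∣Eu∣≤∣J∣
    with augment M (indep-⊆ M (p⊆p∪q ⁅ u ⁆) iEu) iJ (<-≤-trans (x∉p⇒∣p∣<∣p∪⁅x⁆∣ u∉E) ∣Eu∣≤∣J∣)
  ... | y , y∈J , y∉E , iEy = y , J⊆O y∈J , y∉E , iEy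

  -- Independence is not decidable, so instead of a maximal independent
  -- subset of O we grow an independent E ⊆ O on demand.  Augment E by K:
  -- if u is added, E ∪ {u} is independent and the span hypothesis enlarges
  -- E inside O; otherwise the augmented set lies in O ∪ (K - u) and is big
  -- enough to augment K - u by an element of O.
  spanned-exchange : ∀ {O K u} → Spans M O u → u ∉ O → Indep M K → u ∈ K →
                     ∃ λ w → w ∈ O × w ∉ K - u × Indep M ((K - u) ∪ ⁅ w ⁆)
  spanned-exchange {O} {K} {u} spans u∉O iK u∈K =
    growth-induction IndepIn step ((⊥-elim ∘ ∉⊥) , indep-∅ M)
    where
    IndepIn : Subset n → Set
    IndepIn E = E ⊆ O × Indep M E

    step : ∀ {E} → IndepIn E →
           (∃ λ w → w ∈ O × w ∉ K - u × Indep M ((K - u) ∪ ⁅ w ⁆)) ⊎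
           (∃ λ E′ → IndepIn E′ × ∣ E ∣ < ∣ E′ ∣)
    step {E} (E⊆O , iE) with augment-to-size iE iK
    ... | D , E⊆D , D⊆E∪K , iD , ∣K∣≤∣D∣ with u ∈? D
    ...   | yes u∈D with spanned-augment spans E⊆O (u∉O ∘ E⊆O) (indep-⊆ M (p∪⁅y⁆⊆q E⊆D u∈D) iD)
    ...     | y , y∈O , y∉E , iEy =
      inj₂ (E ∪ ⁅ y ⁆ , (p∪⁅y⁆⊆q E⊆O y∈O , iEy) , x∉p⇒∣p∣<∣p∪⁅x⁆∣ y∉E)
    step {E} (E⊆O , iE) | D , E⊆D , D⊆E∪K , iD , ∣K∣≤∣D∣ | no u∉D
      with augment M (indep-⊆ M (p─q⊆p K ⁅ u ⁆) iK) iD (<-≤-trans (x∈p⇒∣p-x∣<∣p∣ u∈K) ∣K∣≤∣D∣)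
    ... | w , w∈D , w∉K-u , iK-u+w = inj₁ (w , w∈O , w∉K-u , iK-u+w)
      where
      w∈O : w ∈ O
      w∈O with x∈p∪q⁻ E K (D⊆E∪K w∈D)
      ... | inj₁ w∈E = E⊆O w∈E
      ... | inj₂ w∈K with w ≟ u
      ...   | yes refl = contradiction w∈D u∉D
      ...   | no w≢u  = contradiction (x∈p∧x≢y⇒x∈p-y w∈K w≢u) w∉K-u

successors-wellFounded : ∀ (G : Digraph n) → Acyclic G → WellFounded (flip (Arc G))
successors-wellFounded G acyclic = Subrelation.wellFounded [_] (spo-noetherian descendant-isSPO)
  where
  descendant-isSPO : IsStrictPartialOrder _≡_ (TransClosure (Arc G))
  descendant-isSPO = record
    { isEquivalence = isEquivalence
    ; irrefl        = λ { refl → acyclic _ }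
    ; trans         = _++_
    ; <-resp-≈      = resp₂ _
    }

redirect : Fin n → Fin n → Fin n → Fin n
redirect v w a with a ≟ v
... | yes _ = w
... | no  _ = a

module _ {v w : Fin n} where

  redirect-∈ : ∀ {T a} → a ∈ T → redirect v w a ∈ (T - v) ∪ ⁅ w ⁆
  redirect-∈ {T} {a} a∈T with a ≟ v
  ... | yes _   = y∈p∪⁅y⁆ (T - v) w
  ... | no  a≢v = p⊆p∪q ⁅ w ⁆ (x∈p∧x≢y⇒x∈p-y a∈T a≢v)

  redirect-injective : ∀ {T a b} → w ∉ T - v → a ∈ T → b ∈ T →
                       redirect v w a ≡ redirect v w b → a ≡ b
  redirect-injective {a = a} {b} w∉T-v a∈T b∈T eq with a ≟ v | b ≟ v
  ... | yes a≡v | yes b≡v = trans a≡v (sym b≡v)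
  ... | yes _   | no  b≢v = contradiction (subst (_∈ _) (sym eq) (x∈p∧x≢y⇒x∈p-y b∈T b≢v)) w∉T-v
  ... | no  a≢v | yes _   = contradiction (subst (_∈ _) eq (x∈p∧x≢y⇒x∈p-y a∈T a≢v)) w∉T-v
  ... | no  _   | no  _   = eq

  redirect-reachable : ∀ {R : Fin n → Fin n → Set} → Star R v w → ∀ a → Star R a (redirect v w a)
  redirect-reachable v⇝w a with a ≟ v
  ... | yes refl = v⇝w
  ... | no  _    = ε

module Routings (M : Matroid n) (G : Digraph n) (acyclic : Acyclic G)
  (spanned : ∀ u → u ∈ V G → ¬ Sink G u → Spans M (out G u) u) (S : Subset n) where

  record Routing (T : Subset n) : Set where
    field
      indep       : Indep M T
      ⊆V          : T ⊆ V G
      ψ           : (u : Fin n) → u ∈ S → Fin n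
      ψ∈T         : ∀ u p → ψ u p ∈ T
      ψ-injective : ∀ u v (p : u ∈ S) (q : v ∈ S) → ψ u p ≡ ψ v q → u ≡ v
      ψ-reachable : ∀ u (p : u ∈ S) → Reachable G u (ψ u p)
  open Routing

  identity-routing : S ⊆ V G → Indep M S → Routing S
  identity-routing S⊆V iS = record
    { indep = iS ; ⊆V = S⊆V ; ψ = λ u _ → u ; ψ∈T = λ _ p → p
    ; ψ-injective = λ _ _ _ _ eq → eq ; ψ-reachable = λ _ _ → ε }

  advance : ∀ {T v w₀} → Routing T → v ∈ T → w₀ ∈ out G v →
            ∃ λ w → w ∈ out G v × Routing ((T - v) ∪ ⁅ w ⁆)
  advance {T} {v} {w₀} r v∈T w₀∈out
    with spanned-exchange M (spanned v (⊆V r v∈T) (λ (_ , empty) → empty (w₀ , w₀∈out)))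
                            (λ v∈out → acyclic v [ v∈out ]) (indep r) v∈T
  ... | w , v→w , w∉T-v , iT′ = w , v→w , record
    { indep       = iT′
    ; ⊆V          = p∪⁅y⁆⊆q (⊆V r ∘ p─q⊆p T ⁅ v ⁆) (proj₂ (arc-V G v w v→w))
    ; ψ           = λ u p → redirect v w (ψ r u p)
    ; ψ∈T         = λ u p → redirect-∈ (ψ∈T r u p)
    ; ψ-injective = λ u u′ p q eq →
        ψ-injective r u u′ p q (redirect-injective w∉T-v (ψ∈T r u p) (ψ∈T r u′ q) eq)
    ; ψ-reachable = λ u p → ψ-reachable r u p ◅◅ redirect-reachable (v→w ◅ ε) (ψ r u p)
    }

  route-to-sink : ∀ {T v} → Acc (flip (Arc G)) v → Routing T → v ∈ T →
                  ∃ λ T′ → Routing T′ × (∀ {t} → t ∈ T′ → t ∈ T - v ⊎ Sink G t)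
  route-to-sink {T} {v} (acc rs) r v∈T with nonempty? (out G v)
  ... | no empty = T , r , settled
    where
    settled : ∀ {t} → t ∈ T → t ∈ T - v ⊎ Sink G t
    settled {t} t∈T with t ≟ v
    ... | yes refl = inj₂ (⊆V r t∈T , empty)
    ... | no  t≢v  = inj₁ (x∈p∧x≢y⇒x∈p-y t∈T t≢v)
  ... | yes (_ , w₀∈out) with advance r v∈T w₀∈out
  ...   | w , v→w , r′ with route-to-sink (rs v→w) r′ (y∈p∪⁅y⁆ (T - v) w)
  ...     | T′ , r″ , settled′ = T′ , r″ , settled
    where
    settled : ∀ {t} → t ∈ T′ → t ∈ T - v ⊎ Sink G t
    settled t∈T′ with settled′ t∈T′
    ... | inj₁ t∈T-v+w-w = inj₁ (x∈p∪⁅y⁆-y⇒x∈p (T - v) t∈T-v+w-w)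
    ... | inj₂ sink      = inj₂ sink

  route-to-sinks : ∀ {T} (L : List (Fin n)) → Routing T → (∀ {t} → t ∈ T → Sink G t ⊎ t List.∈ L) →
                   ∃ λ T′ → Routing T′ × (∀ {t} → t ∈ T′ → Sink G t)
  route-to-sinks [] r pending = _ , r , λ t∈T → [ id , (λ ()) ]′ (pending t∈T)
  route-to-sinks {T} (x ∷ L) r pending with x ∈? T
  ... | no x∉T = route-to-sinks L r pending′
    where
    pending′ : ∀ {t} → t ∈ T → Sink G t ⊎ t List.∈ L
    pending′ t∈T with pending t∈T
    ... | inj₁ sink         = inj₁ sink
    ... | inj₂ (hereₗ refl) = contradiction t∈T x∉T
    ... | inj₂ (thereₗ t∈L) = inj₂ t∈L
  ... | yes x∈T with route-to-sink (successors-wellFounded G acyclic x) r x∈T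
  ...   | T′ , r′ , settled = route-to-sinks L r′ pending′
    where
    pending′ : ∀ {t} → t ∈ T′ → Sink G t ⊎ t List.∈ L
    pending′ t∈T′ with settled t∈T′
    ... | inj₂ sink = inj₁ sink
    ... | inj₁ t∈T-x with pending (p─q⊆p T _ t∈T-x)
    ...   | inj₁ sink         = inj₁ sink
    ...   | inj₂ (hereₗ t≡x)  = contradiction t≡x (x∉⁅y⁆⇒x≢y (x∈p─q⇒x∉q t∈T-x))
    ...   | inj₂ (thereₗ t∈L) = inj₂ t∈L

mainTheorem9 : ∀ {n} (M : Matroid n) (G : Digraph n) → Acyclic G →
    (∀ u → u ∈ V G → ¬ Sink G u → Spans M (out G u) u) →
    (S : Subset n) → S ⊆ V G → Indep M S →
    Σ ((u : Fin n) → u ∈ S → Fin n) λ ψ →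
      (∀ u v (p : u ∈ S) (q : v ∈ S) → ψ u p ≡ ψ v q → u ≡ v) ×
      (∀ u (p : u ∈ S) → Sink G (ψ u p) × Reachable G u (ψ u p))
mainTheorem9 {n} M G acyclic spanned S S⊆V iS
  with route-to-sinks (allFin n) (identity-routing S⊆V iS) (λ {t} _ → inj₂ (∈-allFin t))
  where open Routings M G acyclic spanned S
... | _ , routing , sinks = ψ , ψ-injective , λ u p → sinks (ψ∈T u p) , ψ-reachable u p
  where open Routings.Routing routing
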